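{- Let $G=(V,E)$ be a finite simple graph and let $f_0:V\to\mathbb{N}$ be injective with $\gcd(f_0(u),f_0(v))=1$ for every edge $uv\in E$. Fix a prime $p$ and let $g(x)=px+1$. For $t\ge 0$ define $f_t(v)=g^t(f_0(v))=p^t f_0(v)+c_t$, where $c_t=\frac{p^t-1}{p-1}$. Suppose that for every edge $uv\in E$ and every prime $q$ dividing $|f_0(v)-f_0(u)|$, one has $(p-1)f_0(u)+1\not\equiv p^k\pmod q$ for all $k\in\mathbb{Z}$, i.e. $(p-1)f_0(u)+1\notin\langle p\rangle\subset(\mathbb{Z}/q\mathbb{Z})^\times$. Then for all $t\ge 0$, $\gcd(f_t(u),f_t(v))=1$ for all $uv\in E$, and each $f_t$ is injective on $V$; that is, $(f_t)_{t\ge0}$ is a dynamic coprime labeling of $G$.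
   Context: $\mathbb{N}=\{1,2,3,\dots\}$; $g^t$ denotes the $t$-fold composition of $g$ ($g^0=\mathrm{id}$). A dynamic coprime labeling of $G=(V,E)$ with respect to a map $g$ is a sequence of injective labelings $f_t:V\to\mathbb{N}$ ($t\ge 0$) with $f_{t+1}=g\circ f_t$ and $\gcd(f_t(u),f_t(v))=1$ for every edge $uv\in E$ and every $t\ge 0$. -}

module Defs where

open import Data.Nat using (ℕ; zero; suc; _+_; _*_; _^_; _≥_; ∣_-_∣)
open import Data.Nat.Divisibility using (_∣_)
open import Data.Nat.GCD using (gcd)
open import Data.Fin using (Fin)
open import Relation.Binary.PropositionalEquality using (_≡_)
open import Relation.Nullary using (¬_)
open import Function.Definitions using (Injective)

record SimpleGraph : Set₁ where
  field
    n     : ℕ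
    Adj   : Fin n → Fin n → Set
    sym   : ∀ {u v} → Adj u v → Adj v u
    irrefl : ∀ {v} → ¬ Adj v v

open SimpleGraph public

iter : (ℕ → ℕ) → ℕ → ℕ → ℕ
iter g zero    x = x
iter g (suc t) x = g (iter g t x)

IsLabeling : (G : SimpleGraph) → (Fin (n G) → ℕ) → Set
IsLabeling G f = Injective _≡_ _≡_ f × (∀ v → f v ≥ 1)
  where open import Data.Product using (_×_)

IsCoprimeLabeling : (G : SimpleGraph) → (Fin (n G) → ℕ) → Set
IsCoprimeLabeling G f =
  IsLabeling G f × (∀ u v → Adj G u v → gcd (f u) (f v) ≡ 1)
  where open import Data.Product using (_×_)

IsDynamicCoprimeLabeling : (G : SimpleGraph) → (ℕ → ℕ) → (Fin (n G) → ℕ) → Set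
IsDynamicCoprimeLabeling G g f₀ = ∀ t → IsCoprimeLabeling G (λ v → iter g t (f₀ v))

infix 4 _≡_[mod_]
_≡_[mod_] : ℕ → ℕ → ℕ → Set
a ≡ b [mod q ] = q ∣ ∣ a - b ∣

affine : ℕ → ℕ → ℕ
affine p x = p * x + 1

{-# OPTIONS --safe #-}
module Submission where

-- Write p = m + 1. The map x ↦ m x + 1 conjugates g = affine p to
-- multiplication by p, so m f_t(a) + 1 = (m a + 1) p^t, while
-- f_t(b) − f_t(a) = p^t (b − a). A prime q dividing f_t(a) and f_t(b)
-- divides m f_t(a), hence (m a + 1) p^t ≡ 1 (mod q); in particular q ∤ p^t,
-- so q divides b − a, which is exactly what the hypothesis (with k = t) forbids.
-- Injectivity of f_t is inherited from f₀ because g is injective.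

open import Defs hiding (sym)
open import Data.Nat using (ℕ; zero; suc; _+_; _*_; _∸_; _^_; _≥_; ∣_-_∣; NonZero)
open import Data.Nat.Properties
open import Data.Nat.Divisibility
open import Data.Nat.GCD using (gcd; gcd[m,n]∣m; gcd[m,n]∣n)
open import Data.Nat.Primality using (Prime; prime[2]; ¬prime[0]; ¬prime[1]; euclidsLemma)
open import Data.Nat.Primality.Factorisation using (factorise)
open import Data.Nat.Solver using (module +-*-Solver)
open import Algebra.Properties.CommutativeSemigroup *-commutativeSemigroup using (x∙yz≈y∙xz)
open import Data.Fin using (Fin)
open import Data.List using ([]; _∷_)
open import Data.List.Relation.Unary.All using (_∷_)
open import Data.Product using (_×_; _,_; ∃-syntax; proj₂)
open import Data.Sum using (_⊎_; inj₁; inj₂; [_,_]′)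
open import Data.Empty using (⊥; ⊥-elim)
open import Function.Definitions using (Injective)
open import Relation.Nullary using (¬_)
open import Relation.Binary.PropositionalEquality
  using (_≡_; refl; sym; cong; subst; module ≡-Reasoning)

prime∤1 : ∀ {q} → Prime q → ¬ q ∣ 1
prime∤1 q-prime q∣1 = ¬prime[1] (subst Prime (∣1⇒≡1 q∣1) q-prime)

∣m∧∣n⇒∣∣m-n∣ : ∀ {d m n} → d ∣ m → d ∣ n → d ∣ ∣ m - n ∣
∣m∧∣n⇒∣∣m-n∣ {d} (divides i refl) (divides j refl) =
  divides ∣ i - j ∣ (sym (*-distribʳ-∣-∣ d i j))

≡1⊎prime-divisor : ∀ n → n ≡ 1 ⊎ ∃[ q ] Prime q × q ∣ n
≡1⊎prime-divisor zero = inj₂ (2 , prime[2] , 2 ∣0)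
≡1⊎prime-divisor n@(suc _) with factorise n
... | record { factors = [] ; isFactorisation = n≡1 } = inj₁ n≡1
... | record { factors = q ∷ _ ; isFactorisation = n≡q*qs ; factorsPrime = q-prime ∷ _ } =
  inj₂ (q , q-prime , subst (q ∣_) (sym n≡q*qs) (m∣m*n _))

no-common-prime-divisor⇒gcd≡1 : ∀ m n →
  (∀ {q} → Prime q → q ∣ m → q ∣ n → ⊥) → gcd m n ≡ 1
no-common-prime-divisor⇒gcd≡1 m n noCommon with ≡1⊎prime-divisor (gcd m n)
... | inj₁ gcd≡1 = gcd≡1
... | inj₂ (q , q-prime , q∣gcd) =
  ⊥-elim (noCommon q-prime (∣-trans q∣gcd (gcd[m,n]∣m m n)) (∣-trans q∣gcd (gcd[m,n]∣n m n)))

∣⇒+1≡1[mod] : ∀ {q x} → q ∣ x → x + 1 ≡ 1 [mod q ]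
∣⇒+1≡1[mod] {q} {x} q∣x = subst (q ∣_) (sym ∣x+1-1∣≡x) q∣x
  where
  ∣x+1-1∣≡x : ∣ x + 1 - 1 ∣ ≡ x
  ∣x+1-1∣≡x rewrite +-comm x 1 = ∣-∣-identityʳ x

iter-injective : ∀ {g} → Injective _≡_ _≡_ g → ∀ t → Injective _≡_ _≡_ (iter g t)
iter-injective g-injective zero    eq = eq
iter-injective g-injective (suc t) eq = iter-injective g-injective t (g-injective eq)

affine-injective : ∀ p .{{_ : NonZero p}} → Injective _≡_ _≡_ (affine p)
affine-injective p eq = *-cancelˡ-≡ _ _ p (+-cancelʳ-≡ 1 _ _ eq)

iter-affine-positive : ∀ p t {x} → x ≥ 1 → iter (affine p) t x ≥ 1
iter-affine-positive p zero    x≥1 = x≥1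
iter-affine-positive p (suc t) _   = m≤n+m 1 _

affine-∣-∣ : ∀ p a b → ∣ affine p a - affine p b ∣ ≡ p * ∣ a - b ∣
affine-∣-∣ p a b rewrite +-comm (p * a) 1 | +-comm (p * b) 1 =
  sym (*-distribˡ-∣-∣ p a b)

iter-affine-∣-∣ : ∀ p t a b →
  ∣ iter (affine p) t a - iter (affine p) t b ∣ ≡ p ^ t * ∣ a - b ∣
iter-affine-∣-∣ p zero    a b = sym (+-identityʳ _)
iter-affine-∣-∣ p (suc t) a b = begin
  ∣ affine p (iter (affine p) t a) - affine p (iter (affine p) t b) ∣
    ≡⟨ affine-∣-∣ p _ _ ⟩
  p * ∣ iter (affine p) t a - iter (affine p) t b ∣
    ≡⟨ cong (p *_) (iter-affine-∣-∣ p t a b) ⟩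
  p * (p ^ t * ∣ a - b ∣)
    ≡⟨ *-assoc p (p ^ t) _ ⟨
  p ^ suc t * ∣ a - b ∣ ∎
  where open ≡-Reasoning

affine-conjugate : ∀ m x → m * affine (suc m) x + 1 ≡ suc m * (m * x + 1)
affine-conjugate = solve 2 (λ m x →
  m :* ((con 1 :+ m) :* x :+ con 1) :+ con 1 := (con 1 :+ m) :* (m :* x :+ con 1)) refl
  where open +-*-Solver

iter-affine-conjugate : ∀ m t x →
  m * iter (affine (suc m)) t x + 1 ≡ (m * x + 1) * suc m ^ t
iter-affine-conjugate m zero    x = sym (*-identityʳ _)
iter-affine-conjugate m (suc t) x = begin
  m * affine p (iter (affine p) t x) + 1 ≡⟨ affine-conjugate m _ ⟩
  p * (m * iter (affine p) t x + 1)      ≡⟨ cong (p *_) (iter-affine-conjugate m t x) ⟩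
  p * ((m * x + 1) * p ^ t)              ≡⟨ x∙yz≈y∙xz p (m * x + 1) (p ^ t) ⟩
  (m * x + 1) * p ^ suc t                ∎
  where
  open ≡-Reasoning
  p = suc m

iter-affine-coprime : ∀ m t a b →
  (∀ {q} → Prime q → q ∣ ∣ b - a ∣ → ¬ ((m * a + 1) * suc m ^ t ≡ 1 [mod q ])) →
  gcd (iter (affine (suc m)) t a) (iter (affine (suc m)) t b) ≡ 1
iter-affine-coprime m t a b hyp = no-common-prime-divisor⇒gcd≡1 fa fb noCommon
  where
  p  = suc m
  fa = iter (affine p) t a
  fb = iter (affine p) t b
  noCommon : ∀ {q} → Prime q → q ∣ fa → q ∣ fb → ⊥
  noCommon {q} q-prime q∣fa q∣fb = [ q∤p^t , q∤b-a ]′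
    (euclidsLemma (p ^ t) ∣ b - a ∣ q-prime
      (subst (q ∣_) (iter-affine-∣-∣ p t b a) (∣m∧∣n⇒∣∣m-n∣ q∣fb q∣fa)))
    where
    q∣m*fa : q ∣ m * fa
    q∣m*fa = ∣n⇒∣m*n m q∣fa
    q∤p^t : ¬ q ∣ p ^ t
    q∤p^t q∣p^t = prime∤1 q-prime (∣m+n∣m⇒∣n q∣m*fa+1 q∣m*fa)
      where
      q∣m*fa+1 : q ∣ m * fa + 1
      q∣m*fa+1 = subst (q ∣_) (sym (iter-affine-conjugate m t a)) (∣n⇒∣m*n (m * a + 1) q∣p^t)
    q∤b-a : ¬ q ∣ ∣ b - a ∣
    q∤b-a q∣b-a = hyp q-prime q∣b-a
      (subst (_≡ 1 [mod q ]) (iter-affine-conjugate m t a) (∣⇒+1≡1[mod] q∣m*fa))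

-- The coprimality of f₀ is not used: it is the case t = 0 of iter-affine-coprime.
mainTheorem10 : (G : SimpleGraph) (f₀ : Fin (n G) → ℕ) →
    IsCoprimeLabeling G f₀ →
    (p : ℕ) → Prime p →
    (∀ u v → Adj G u v → (q : ℕ) → Prime q → q ∣ ∣ f₀ v - f₀ u ∣ →
      (k : ℕ) →
        ¬ ((p ∸ 1) * f₀ u + 1 ≡ p ^ k [mod q ]) ×
        ¬ (((p ∸ 1) * f₀ u + 1) * p ^ k ≡ 1 [mod q ])) →
    IsDynamicCoprimeLabeling G (affine p) f₀
mainTheorem10 _ _ _ zero 0-prime _ = ⊥-elim (¬prime[0] 0-prime)
mainTheorem10 G f₀ ((f₀-injective , f₀-positive) , _) p@(suc m) _ hyp t =
  (f_t-injective , f_t-positive) , f_t-coprime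
  where
  f_t-injective : Injective _≡_ _≡_ (λ v → iter (affine p) t (f₀ v))
  f_t-injective eq = f₀-injective (iter-injective (affine-injective p) t eq)
  f_t-positive : ∀ v → iter (affine p) t (f₀ v) ≥ 1
  f_t-positive v = iter-affine-positive p t (f₀-positive v)
  f_t-coprime : ∀ u v → Adj G u v → gcd (iter (affine p) t (f₀ u)) (iter (affine p) t (f₀ v)) ≡ 1
  f_t-coprime u v uv = iter-affine-coprime m t (f₀ u) (f₀ v)
    (λ q-prime q∣b-a → proj₂ (hyp u v uv _ q-prime q∣b-a t))
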